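{- Let $D$ be a digraph of order $n$ with maximum out-degree $\Delta^+$. (i) If $D$ has no isolated vertices, then $\gamma_t(D)=2n/(2\Delta^++1)$ if and only if $D\in\Theta$. (ii) If every vertex of $D$ has in-degree at least $1$, then $\gamma_o(D)=n/\Delta^+$ if and only if $D\in\Sigma$.
   Context: Digraphs are finite, without loops or multiple arcs (opposite arcs allowed). A set $S\subseteq V(D)$ is dominating if every vertex of $V(D)\setminus S$ has an in-neighbor in $S$. A total dominating set is a dominating set $S$ such that the subdigraph induced by $S$ has no isolated vertices; $\gamma_t(D)$ is the minimum size of a total dominating set. An open dominating set is a set $S$ such that every vertex of $V(D)$ has an in-neighbor in $S$; $\gamma_o(D)$ is the minimum size of an open dominating set. For $S\subseteq V(D)$ and $u\in S$, a private out-neighbor of $u$ with respect to $S$ is a vertex $v$ with $(\{v\}\cup N^-(v))\cap S=\{u\}$. Family $\Theta$: take an integer $k\ge 0$ and $r\ge1$ and a digraph $D'$ with vertex set $\{u_1,v_1,\dots,u_r,v_r\}$ and arc set $\{(u_1,v_1),\dots,(u_r,v_r)\}$. Add, for each $u_i$, $k$ new vertices that are private out-neighbors of $u_i$ with respect to $V(D')$, and for each $v_i$, $k+1$ new vertices that are private out-neighbors of $v_i$ with respect to $V(D')$ (so each new vertex receives exactly one arc from $V(D')$). Then add arbitrary arcs among the new vertices and arbitrary arcs from new vertices to vertices $u_i$ or $v_j$, subject to every new vertex having out-degree at most $k+1$. The resulting digraphs $D$ (which have $\Delta^+(D)=k+1$) form $\Theta$. Family $\Sigma$: take a contrafunctional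 digraph $D'$ (every vertex has in-degree exactly $1$) and an integer $k\ge\Delta^+(D')$. For each vertex $v$ of $D'$ add $k-\deg^+_{D'}(v)$ new vertices that are private out-neighbors of $v$ with respect to $V(D')$. Then add arbitrary arcs among the new vertices and arbitrary arcs from new vertices to vertices of $D'$, subject to every new vertex having out-degree at most $k$. The resulting digraphs $D$ (which have $\Delta^+(D)=k$) form $\Sigma$. -}

module Defs where

open import Data.Nat using (ℕ; zero; suc; _+_; _*_; _∸_; _≤_; _⊔_)
open import Data.Bool using (Bool; true; false)
open import Data.Fin using (Fin)
open import Data.Fin.Subset using (Subset; _∈_; _∉_; _∩_; ∁; ∣_∣)
open import Data.Vec using (tabulate)
import Data.List as List
open import Data.Product using (Σ; ∃; _×_; _,_)
open import Data.Sum using (_⊎_)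
open import Relation.Binary.PropositionalEquality using (_≡_; _≢_)
open import Relation.Nullary using (¬_)

-- A finite digraph on vertex set Fin n, given by a Boolean adjacency
-- relation (arc x y ≡ true means (x,y) is an arc); no loops, no multiple
-- arcs (automatic for a relation), opposite arcs allowed.
record Digraph : Set where
  field
    n        : ℕ
    arc      : Fin n → Fin n → Bool
    loopless : ∀ x → arc x x ≡ false

module _ (D : Digraph) where
  open Digraph D

  Arc : Fin n → Fin n → Set
  Arc x y = arc x y ≡ true

  N⁺ : Fin n → Subset n
  N⁺ x = tabulate (arc x)

  outdeg : Fin n → ℕ
  outdeg x = ∣ N⁺ x ∣

  -- maximum out-degree Δ⁺(D) (0 for the empty digraph)
  Δ⁺ : ℕ
  Δ⁺ = List.foldr _⊔_ 0 (List.map outdeg (List.allFin n))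

  Isolated : Fin n → Set
  Isolated x = ∀ y → ¬ Arc y x × ¬ Arc x y

  NoIsolated : Set
  NoIsolated = ∀ x → ¬ Isolated x

  MinInDeg≥1 : Set
  MinInDeg≥1 = ∀ x → ∃ λ y → Arc y x

  Dominating : Subset n → Set
  Dominating S = ∀ v → v ∉ S → ∃ λ u → u ∈ S × Arc u v

  InducedNoIsolated : Subset n → Set
  InducedNoIsolated S = ∀ u → u ∈ S → ∃ λ w → w ∈ S × (Arc u w ⊎ Arc w u)

  TotalDominating : Subset n → Set
  TotalDominating S = Dominating S × InducedNoIsolated S

  OpenDominating : Subset n → Set
  OpenDominating S = ∀ v → ∃ λ u → u ∈ S × Arc u v

  IsMinSize : (Subset n → Set) → ℕ → Set
  IsMinSize P g = (∃ λ S → P S × ∣ S ∣ ≡ g) × (∀ S → P S → g ≤ ∣ S ∣)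

  IsγT : ℕ → Set
  IsγT = IsMinSize TotalDominating

  Isγo : ℕ → Set
  Isγo = IsMinSize OpenDominating

  -- w is a private out-neighbour of u with respect to S:
  -- ({w} ∪ N⁻(w)) ∩ S = {u}
  PrivateOut : Subset n → Fin n → Fin n → Set
  PrivateOut S u w =
    u ∈ S × (u ≡ w ⊎ Arc u w) × (∀ y → y ∈ S → (y ≡ w ⊎ Arc y w) → y ≡ u)

  -- D ∈ Θ (up to isomorphism): the core V(D') is a subset C of V(D),
  -- enumerated as u₁,v₁,…,u_r,v_r (all distinct), D[C] has exactly the
  -- arcs (u_i,v_i); every other vertex is a private out-neighbour (w.r.t. C)
  -- of a core vertex; u_i has exactly k and v_i exactly k+1 out-neighbours
  -- outside C; every non-core vertex has out-degree at most k+1.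
  -- Arcs from non-core vertices are otherwise arbitrary.
  InΘ : Set
  InΘ =
    Σ ℕ λ k → Σ ℕ λ r → Σ (Subset n) λ C →
    Σ (Fin r → Fin n) λ u → Σ (Fin r → Fin n) λ v →
      1 ≤ r
    × (∀ i j → u i ≡ u j → i ≡ j)
    × (∀ i j → v i ≡ v j → i ≡ j)
    × (∀ i j → u i ≢ v j)
    × (∀ i → u i ∈ C × v i ∈ C)
    × (∀ x → x ∈ C → ∃ λ i → x ≡ u i ⊎ x ≡ v i)
    × (∀ i j → arc (u i) (u j) ≡ false)
    × (∀ i j → arc (v i) (v j) ≡ false)
    × (∀ i j → arc (v i) (u j) ≡ false)
    × (∀ i j → Arc (u i) (v j) → i ≡ j)
    × (∀ i → Arc (u i) (v i))
    × (∀ i → ∣ N⁺ (u i) ∩ ∁ C ∣ ≡ k)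
    × (∀ i → ∣ N⁺ (v i) ∩ ∁ C ∣ ≡ suc k)
    × (∀ w → w ∉ C → ∃ λ x → PrivateOut C x w)
    × (∀ w → w ∉ C → outdeg w ≤ suc k)

  -- D ∈ Σ (up to isomorphism): the core V(D') is a subset C of V(D) with
  -- D' = D[C] contrafunctional (every core vertex has exactly one
  -- in-neighbour in C); k ≥ Δ⁺(D'); each core vertex x has exactly
  -- k ∸ deg⁺_{D'}(x) out-neighbours outside C; every non-core vertex is a
  -- private out-neighbour (w.r.t. C) of a core vertex and has out-degree ≤ k.
  InΣ : Set
  InΣ =
    Σ ℕ λ k → Σ (Subset n) λ C →
      (∀ x → x ∈ C → ∃ λ y → y ∈ C × Arc y x)
    × (∀ x y z → x ∈ C → y ∈ C → z ∈ C → Arc y x → Arc z x → y ≡ z)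
    × (∀ x → x ∈ C → ∣ N⁺ x ∩ C ∣ ≤ k)
    × (∀ x → x ∈ C → ∣ N⁺ x ∩ ∁ C ∣ ≡ k ∸ ∣ N⁺ x ∩ C ∣)
    × (∀ w → w ∉ C → ∃ λ x → PrivateOut C x w)
    × (∀ w → w ∉ C → outdeg w ≤ k)

-- Double count the arcs with tail in a set S: there are at most ∣S∣·Δ⁺ of
-- them. If S is open dominating, every vertex is the head of one, so
-- n ≤ ∣S∣·Δ⁺. If S is total dominating, every vertex outside S is the head of
-- one, and every vertex of S is an end of one of the a arcs inside S, so
-- ∣S∣ ≤ 2a; together 2n ≤ ∣S∣·(2Δ⁺+1). Equality forces every count to be tight:
-- the vertices of S have out-degree Δ⁺, each dominated vertex has exactly one
-- in-neighbour in S, and (total case) the arcs inside S form a perfect matching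
-- of S. Such sets are exactly the cores of the digraphs in Σ and Θ; conversely
-- such a core attains the bound, and then so does every minimum dominating set.
module Submission where

open import Defs
open import Data.Nat using (ℕ; zero; suc; _+_; _*_; _∸_; _≤_; _⊔_; z≤n; s≤s)
import Data.Nat as ℕ
open import Data.Nat.Properties hiding (_≟_)
open import Data.Nat.Tactic.RingSolver using (solve-∀)
open import Algebra.Properties.CommutativeSemigroup +-commutativeSemigroup using (interchange)
open import Data.Bool using (Bool; true; false)
open import Data.Bool.Properties using (¬-not; not-¬)
open import Data.Fin using (Fin; zero; suc; _≟_; fromℕ<)
open import Data.Fin.Properties using (toℕ<n)
open import Data.Fin.Subset
  using (Subset; inside; outside; _∈_; _∉_; _∩_; ∁; ⊤; ⁅_⁆; _-_; Nonempty; Empty; ∣_∣)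
open import Data.Fin.Subset.Properties
  using ( ∣⁅x⁆∣≡1; x∈⁅x⁆; x∈⁅y⁆⇒x≡y; p⊆q⇒∣p∣≤∣q∣; x∈p∧x≢y⇒x∈p-y; x∈p⇒∣p-x∣<∣p∣
        ; Empty-unique; ∣⊥∣≡0; nonempty?; x∈p∩q⁺; x∈p∩q⁻; x∈∁p⇒x∉p; x∉p⇒x∈∁p
        ; ∈⊤; ∣⊤∣≡n; ∩-identityʳ; ∣∁p∣≡n∸∣p∣; ∣p∣≤n; ∣p∩q∣≤∣p∣; _∈?_ )
open import Data.Vec using ([]; _∷_; here; there; tabulate)
import Data.Vec as Vec
open import Data.Vec.Properties using (lookup∘tabulate; []=⇒lookup; lookup⇒[]=)
open import Data.List using (List; length; lookup; filter; allFin)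
import Data.List as List
open import Data.List.Relation.Unary.AllPairs using (_∷_)
import Data.List.Relation.Unary.All as All
open import Data.List.Relation.Unary.Any using (index; here; there)
open import Data.List.Relation.Unary.Any.Properties using (lookup-index)
open import Data.List.Relation.Unary.Unique.Propositional using (Unique)
open import Data.List.Relation.Unary.Unique.Propositional.Properties using (allFin⁺; filter⁺)
open import Data.List.Membership.Propositional using () renaming (_∈_ to _∈ₗ_)
open import Data.List.Membership.Propositional.Properties using (∈-lookup; ∈-filter⁺; ∈-filter⁻; ∈-allFin)
open import Data.Product using (∃; _×_; _,_; proj₁; proj₂)
open import Data.Sum using (_⊎_; inj₁; inj₂)
open import Relation.Binary.PropositionalEquality
open import Relation.Nullary using (¬_; yes; no; contradiction; _×-dec_)
open import Relation.Unary using (Decidable)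
open import Function using (_∘_)
open import Function.Bundles using (_⇔_; mk⇔; Equivalence)

+-mono-≤-tight : ∀ {a b c d} → a ≤ c → b ≤ d → c + d ≤ a + b → a ≡ c × b ≡ d
+-mono-≤-tight {a} {b} {c} {d} a≤c b≤d c+d≤a+b =
  ≤-antisym a≤c (+-cancelʳ-≤ b c a (≤-trans (+-monoʳ-≤ c b≤d) c+d≤a+b)) ,
  ≤-antisym b≤d (+-cancelˡ-≤ c d b (≤-trans c+d≤a+b (+-monoˡ-≤ b a≤c)))

m+n≡1⇒[1,0]⊎[0,1] : ∀ m n → m + n ≡ 1 → (m ≡ 1 × n ≡ 0) ⊎ (m ≡ 0 × n ≡ 1)
m+n≡1⇒[1,0]⊎[0,1] 1             0             _  = inj₁ (refl , refl)
m+n≡1⇒[1,0]⊎[0,1] 0             1             _  = inj₂ (refl , refl)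
m+n≡1⇒[1,0]⊎[0,1] 0             (suc (suc _)) ()
m+n≡1⇒[1,0]⊎[0,1] (suc zero)    (suc _)       ()
m+n≡1⇒[1,0]⊎[0,1] (suc (suc _)) _             ()

2*[m+n]≡m+[m+[n+n]] : ∀ m n → 2 * (m + n) ≡ m + (m + (n + n))
2*[m+n]≡m+[m+[n+n]] = solve-∀

m*[2n+1]≡m+[mn+mn] : ∀ m n → m * (2 * n + 1) ≡ m + (m * n + m * n)
m*[2n+1]≡m+[mn+mn] = solve-∀

total-arithmetic : ∀ {g c a b d} → c ≤ b → g ≤ a + a → a + b ≤ g * d → 2 * (g + c) ≤ g * (2 * d + 1)
total-arithmetic {g} {c} {a} {b} {d} c≤b g≤2a a+b≤gd = begin
  2 * (g + c)                ≡⟨ 2*[m+n]≡m+[m+[n+n]] g c ⟩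
  g + (g + (c + c))          ≤⟨ +-monoʳ-≤ g (+-mono-≤ g≤2a (+-mono-≤ c≤b c≤b)) ⟩
  g + ((a + a) + (b + b))    ≡⟨ cong (g +_) (interchange a a b b) ⟩
  g + ((a + b) + (a + b))    ≤⟨ +-monoʳ-≤ g (+-mono-≤ a+b≤gd a+b≤gd) ⟩
  g + (g * d + g * d)        ≡⟨ m*[2n+1]≡m+[mn+mn] g d ⟨
  g * (2 * d + 1)            ∎
  where open ≤-Reasoning

total-arithmetic-tight : ∀ {g c a b d} → c ≤ b → g ≤ a + a → a + b ≤ g * d →
                         g * (2 * d + 1) ≤ 2 * (g + c) → c ≡ b × g ≡ a + a × a + b ≡ g * d
total-arithmetic-tight {g} {c} {a} {b} {d} c≤b g≤2a a+b≤gd tight = c≡b , g≡2a , a+b≡gd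
  where
  2gd≤g+2c : g * d + g * d ≤ g + (c + c)
  2gd≤g+2c = +-cancelˡ-≤ g _ _ (subst₂ _≤_ (m*[2n+1]≡m+[mn+mn] g d) (2*[m+n]≡m+[m+[n+n]] g c) tight)
  g+2c≤2[a+b] : g + (c + c) ≤ (a + b) + (a + b)
  g+2c≤2[a+b] = ≤-trans (+-mono-≤ g≤2a (+-mono-≤ c≤b c≤b)) (≤-reflexive (interchange a a b b))
  g≡2a×2c≡2b : g ≡ a + a × c + c ≡ b + b
  g≡2a×2c≡2b = +-mono-≤-tight g≤2a (+-mono-≤ c≤b c≤b)
    (≤-trans (≤-reflexive (interchange a a b b)) (≤-trans (+-mono-≤ a+b≤gd a+b≤gd) 2gd≤g+2c))
  g≡2a = proj₁ g≡2a×2c≡2b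
  c≡b = proj₁ (+-mono-≤-tight c≤b c≤b (≤-reflexive (sym (proj₂ g≡2a×2c≡2b))))
  a+b≡gd = proj₁ (+-mono-≤-tight a+b≤gd a+b≤gd (≤-trans 2gd≤g+2c g+2c≤2[a+b]))

total-arithmetic-≡ : ∀ {g c a b d} → c ≡ b → g ≡ a + a → a + b ≡ g * d → g * (2 * d + 1) ≡ 2 * (g + c)
total-arithmetic-≡ {c = c} {a} {d = d} refl refl a+c≡gd = begin
  (a + a) * (2 * d + 1)                      ≡⟨ m*[2n+1]≡m+[mn+mn] (a + a) d ⟩
  (a + a) + ((a + a) * d + (a + a) * d)      ≡⟨ cong (λ t → (a + a) + (t + t)) a+c≡gd ⟨
  (a + a) + ((a + c) + (a + c))              ≡⟨ cong ((a + a) +_) (interchange a c a c) ⟩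
  (a + a) + ((a + a) + (c + c))              ≡⟨ 2*[m+n]≡m+[m+[n+n]] (a + a) c ⟨
  2 * ((a + a) + c)                          ∎
  where open ≡-Reasoning

module _ {m : ℕ} {b : Fin m → Bool} {x : Fin m} where

  ∈-tabulate⁻ : x ∈ tabulate b → b x ≡ true
  ∈-tabulate⁻ x∈ = trans (sym (lookup∘tabulate b x)) ([]=⇒lookup x∈)

  ∈-tabulate⁺ : b x ≡ true → x ∈ tabulate b
  ∈-tabulate⁺ bx = lookup⇒[]= x (tabulate b) (trans (lookup∘tabulate b x) bx)

module _ {n : ℕ} where

  x∈p⇒1≤∣p∣ : ∀ {p : Subset n} {x} → x ∈ p → 1 ≤ ∣ p ∣
  x∈p⇒1≤∣p∣ {p} {x} x∈p = begin
    1             ≡⟨ ∣⁅x⁆∣≡1 x ⟨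
    ∣ ⁅ x ⁆ ∣     ≤⟨ p⊆q⇒∣p∣≤∣q∣ (λ y∈⁅x⁆ → subst (_∈ p) (sym (x∈⁅y⁆⇒x≡y x y∈⁅x⁆)) x∈p) ⟩
    ∣ p ∣         ∎
    where open ≤-Reasoning

  Empty⇒∣p∣≡0 : ∀ {p : Subset n} → Empty p → ∣ p ∣ ≡ 0
  Empty⇒∣p∣≡0 empty = trans (cong ∣_∣ (Empty-unique empty)) (∣⊥∣≡0 n)

  1≤∣p∣⇒Nonempty : ∀ {p : Subset n} → 1 ≤ ∣ p ∣ → Nonempty p
  1≤∣p∣⇒Nonempty {p} 1≤∣p∣ with nonempty? p
  ... | yes nonempty = nonempty
  ... | no  empty    = contradiction (Empty⇒∣p∣≡0 empty) (≢-sym (<⇒≢ 1≤∣p∣))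

  ∣p∣≤1⇒unique : ∀ {p : Subset n} {x y} → ∣ p ∣ ≤ 1 → x ∈ p → y ∈ p → x ≡ y
  ∣p∣≤1⇒unique {p} {x} {y} ∣p∣≤1 x∈p y∈p with x ≟ y
  ... | yes x≡y = x≡y
  ... | no  x≢y = contradiction ∣p∣≤1 (<⇒≱ (begin-strict
    1             ≤⟨ x∈p⇒1≤∣p∣ (x∈p∧x≢y⇒x∈p-y y∈p (x≢y ∘ sym)) ⟩
    ∣ p - x ∣     <⟨ x∈p⇒∣p-x∣<∣p∣ x∈p ⟩
    ∣ p ∣         ∎))
    where open ≤-Reasoning

  unique⇒∣p∣≡1 : ∀ {p : Subset n} {x} → x ∈ p → (∀ {y} → y ∈ p → y ≡ x) → ∣ p ∣ ≡ 1
  unique⇒∣p∣≡1 {p} {x} x∈p unique = ≤-antisym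
    (≤-trans (p⊆q⇒∣p∣≤∣q∣ (λ y∈p → subst (_∈ ⁅ x ⁆) (sym (unique y∈p)) (x∈⁅x⁆ x)))
             (≤-reflexive (∣⁅x⁆∣≡1 x)))
    (x∈p⇒1≤∣p∣ x∈p)

∣p∩q∣+∣p∩∁q∣≡∣p∣ : ∀ {n} (p q : Subset n) → ∣ p ∩ q ∣ + ∣ p ∩ ∁ q ∣ ≡ ∣ p ∣
∣p∩q∣+∣p∩∁q∣≡∣p∣ []            []            = refl
∣p∩q∣+∣p∩∁q∣≡∣p∣ (inside  ∷ p) (inside  ∷ q) = cong suc (∣p∩q∣+∣p∩∁q∣≡∣p∣ p q)
∣p∩q∣+∣p∩∁q∣≡∣p∣ (inside  ∷ p) (outside ∷ q) = trans (+-suc _ _) (cong suc (∣p∩q∣+∣p∩∁q∣≡∣p∣ p q))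
∣p∩q∣+∣p∩∁q∣≡∣p∣ (outside ∷ p) (inside  ∷ q) = ∣p∩q∣+∣p∩∁q∣≡∣p∣ p q
∣p∩q∣+∣p∩∁q∣≡∣p∣ (outside ∷ p) (outside ∷ q) = ∣p∩q∣+∣p∩∁q∣≡∣p∣ p q

lookup-injective : ∀ {A : Set} {xs : List A} → Unique xs → ∀ i j → lookup xs i ≡ lookup xs j → i ≡ j
lookup-injective (_  ∷ _)    zero    zero    _  = refl
lookup-injective (x≢ ∷ _)    zero    (suc j) eq = contradiction eq (All.lookup x≢ (∈-lookup j))
lookup-injective (x≢ ∷ _)    (suc i) zero    eq = contradiction (sym eq) (All.lookup x≢ (∈-lookup i))
lookup-injective (_  ∷ uniq) (suc i) (suc j) eq = cong suc (lookup-injective uniq i j eq)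

record Enumeration {n} (P : Fin n → Set) : Set where
  field
    size      : ℕ
    at        : Fin size → Fin n
    injective : ∀ i j → at i ≡ at j → i ≡ j
    sound     : ∀ i → P (at i)
    complete  : ∀ {x} → P x → ∃ λ i → at i ≡ x

enumerate : ∀ {n} {P : Fin n → Set} → Decidable P → Enumeration P
enumerate {n} P? = record
  { size      = length xs
  ; at        = lookup xs
  ; injective = lookup-injective (filter⁺ P? (allFin⁺ n))
  ; sound     = λ i → proj₂ (∈-filter⁻ P? {xs = allFin n} (∈-lookup i))
  ; complete  = λ {x} Px → let x∈xs = ∈-filter⁺ P? (∈-allFin x) Px in index x∈xs , sym (lookup-index x∈xs)
  }
  where xs = filter P? (allFin n)

∑∈ : ∀ {n} → Subset n → (Fin n → ℕ) → ℕ
∑∈ []            f = 0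
∑∈ (inside  ∷ p) f = f zero + ∑∈ p (f ∘ suc)
∑∈ (outside ∷ p) f = ∑∈ p (f ∘ suc)

syntax ∑∈ p (λ x → e) = ∑[ x ∈ p ] e

∑∈-cong : ∀ {n} (p : Subset n) {f g : Fin n → ℕ} → (∀ {x} → x ∈ p → f x ≡ g x) → ∑∈ p f ≡ ∑∈ p g
∑∈-cong []            f≡g = refl
∑∈-cong (inside  ∷ p) f≡g = cong₂ _+_ (f≡g here) (∑∈-cong p (f≡g ∘ there))
∑∈-cong (outside ∷ p) f≡g = ∑∈-cong p (f≡g ∘ there)

∑∈-mono-≤ : ∀ {n} (p : Subset n) {f g : Fin n → ℕ} → (∀ {x} → x ∈ p → f x ≤ g x) → ∑∈ p f ≤ ∑∈ p g
∑∈-mono-≤ []            f≤g = z≤n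
∑∈-mono-≤ (inside  ∷ p) f≤g = +-mono-≤ (f≤g here) (∑∈-mono-≤ p (f≤g ∘ there))
∑∈-mono-≤ (outside ∷ p) f≤g = ∑∈-mono-≤ p (f≤g ∘ there)

∑∈-mono-≤-tight : ∀ {n} (p : Subset n) {f g : Fin n → ℕ} → (∀ {x} → x ∈ p → f x ≤ g x) →
                  ∑∈ p g ≤ ∑∈ p f → ∀ {x} → x ∈ p → f x ≡ g x
∑∈-mono-≤-tight (inside  ∷ p) f≤g ∑g≤∑f here        =
  proj₁ (+-mono-≤-tight (f≤g here) (∑∈-mono-≤ p (f≤g ∘ there)) ∑g≤∑f)
∑∈-mono-≤-tight (inside  ∷ p) f≤g ∑g≤∑f (there x∈p) = ∑∈-mono-≤-tight p (f≤g ∘ there)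
  (≤-reflexive (sym (proj₂ (+-mono-≤-tight (f≤g here) (∑∈-mono-≤ p (f≤g ∘ there)) ∑g≤∑f)))) x∈p
∑∈-mono-≤-tight (outside ∷ p) f≤g ∑g≤∑f (there x∈p) = ∑∈-mono-≤-tight p (f≤g ∘ there) ∑g≤∑f x∈p

∑∈-const : ∀ {n} (p : Subset n) c → ∑[ x ∈ p ] c ≡ ∣ p ∣ * c
∑∈-const []            c = refl
∑∈-const (inside  ∷ p) c = cong (c +_) (∑∈-const p c)
∑∈-const (outside ∷ p) c = ∑∈-const p c

∑∈-distrib-+ : ∀ {n} (p : Subset n) (f g : Fin n → ℕ) → ∑[ x ∈ p ] (f x + g x) ≡ ∑∈ p f + ∑∈ p g
∑∈-distrib-+ []            f g = refl
∑∈-distrib-+ (inside  ∷ p) f g = trans (cong (f zero + g zero +_) (∑∈-distrib-+ p (f ∘ suc) (g ∘ suc)))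
                                       (interchange (f zero) (g zero) _ _)
∑∈-distrib-+ (outside ∷ p) f g = ∑∈-distrib-+ p (f ∘ suc) (g ∘ suc)

∑∈-comm : ∀ {m n} (p : Subset m) (q : Subset n) (f : Fin m → Fin n → ℕ) →
          ∑[ x ∈ p ] ∑[ y ∈ q ] f x y ≡ ∑[ y ∈ q ] ∑[ x ∈ p ] f x y
∑∈-comm []            q f = sym (trans (∑∈-const q 0) (*-zeroʳ ∣ q ∣))
∑∈-comm (inside  ∷ p) q f = trans (cong (∑∈ q (f zero) +_) (∑∈-comm p q (f ∘ suc)))
                                  (sym (∑∈-distrib-+ q (f zero) _))
∑∈-comm (outside ∷ p) q f = ∑∈-comm p q (f ∘ suc)

χ : Bool → ℕ
χ true  = 1
χ false = 0

∣p∩q∣≡∑∈ : ∀ {n} (p q : Subset n) → ∣ p ∩ q ∣ ≡ ∑[ y ∈ q ] χ (Vec.lookup p y)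
∣p∩q∣≡∑∈ []            []            = refl
∣p∩q∣≡∑∈ (inside  ∷ p) (inside  ∷ q) = cong suc (∣p∩q∣≡∑∈ p q)
∣p∩q∣≡∑∈ (outside ∷ p) (inside  ∷ q) = ∣p∩q∣≡∑∈ p q
∣p∩q∣≡∑∈ (inside  ∷ p) (outside ∷ q) = ∣p∩q∣≡∑∈ p q
∣p∩q∣≡∑∈ (outside ∷ p) (outside ∷ q) = ∣p∩q∣≡∑∈ p q

module _ {n} (p : Subset n) {f : Fin n → ℕ} {c : ℕ} where

  ∑∈-≥ : (∀ {x} → x ∈ p → c ≤ f x) → ∣ p ∣ * c ≤ ∑∈ p f
  ∑∈-≥ c≤f = ≤-trans (≤-reflexive (sym (∑∈-const p c))) (∑∈-mono-≤ p c≤f)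

  ∑∈-≥-tight : (∀ {x} → x ∈ p → c ≤ f x) → ∑∈ p f ≤ ∣ p ∣ * c → ∀ {x} → x ∈ p → f x ≡ c
  ∑∈-≥-tight c≤f ∑f≤ x∈p =
    sym (∑∈-mono-≤-tight p c≤f (≤-trans ∑f≤ (≤-reflexive (sym (∑∈-const p c)))) x∈p)

  ∑∈-≤ : (∀ {x} → x ∈ p → f x ≤ c) → ∑∈ p f ≤ ∣ p ∣ * c
  ∑∈-≤ f≤c = ≤-trans (∑∈-mono-≤ p f≤c) (≤-reflexive (∑∈-const p c))

  ∑∈-≤-tight : (∀ {x} → x ∈ p → f x ≤ c) → ∣ p ∣ * c ≤ ∑∈ p f → ∀ {x} → x ∈ p → f x ≡ c
  ∑∈-≤-tight f≤c ≤∑f = ∑∈-mono-≤-tight p f≤c (≤-trans (≤-reflexive (∑∈-const p c)) ≤∑f)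

  ∑∈-≡ : (∀ {x} → x ∈ p → f x ≡ c) → ∑∈ p f ≡ ∣ p ∣ * c
  ∑∈-≡ f≡c = trans (∑∈-cong p f≡c) (∑∈-const p c)

module Domination (D : Digraph) where
  open Digraph D

  N⁻ : Fin n → Subset n
  N⁻ y = tabulate (λ x → arc x y)

  module _ {S : Subset n} {x y : Fin n} where

    ∈N⁺∩⁺ : Arc D x y → y ∈ S → y ∈ N⁺ D x ∩ S
    ∈N⁺∩⁺ xy y∈S = x∈p∩q⁺ (∈-tabulate⁺ xy , y∈S)

    ∈N⁺∩⁻ : y ∈ N⁺ D x ∩ S → Arc D x y × y ∈ S
    ∈N⁺∩⁻ y∈ = let (y∈N⁺ , y∈S) = x∈p∩q⁻ _ S y∈ in ∈-tabulate⁻ y∈N⁺ , y∈S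

    ∈N⁻∩⁺ : Arc D x y → x ∈ S → x ∈ N⁻ y ∩ S
    ∈N⁻∩⁺ xy x∈S = x∈p∩q⁺ (∈-tabulate⁺ xy , x∈S)

    ∈N⁻∩⁻ : x ∈ N⁻ y ∩ S → Arc D x y × x ∈ S
    ∈N⁻∩⁻ x∈ = let (x∈N⁻ , x∈S) = x∈p∩q⁻ _ S x∈ in ∈-tabulate⁻ x∈N⁻ , x∈S

  module _ {S : Subset n} where

    indeg-pos : ∀ {x y} → x ∈ S → Arc D x y → 1 ≤ ∣ N⁻ y ∩ S ∣
    indeg-pos x∈S xy = x∈p⇒1≤∣p∣ (∈N⁻∩⁺ xy x∈S)

    outdeg-pos : ∀ {x y} → y ∈ S → Arc D x y → 1 ≤ ∣ N⁺ D x ∩ S ∣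
    outdeg-pos y∈S xy = x∈p⇒1≤∣p∣ (∈N⁺∩⁺ xy y∈S)

    in-neighbour : ∀ {y} → 1 ≤ ∣ N⁻ y ∩ S ∣ → ∃ λ x → x ∈ S × Arc D x y
    in-neighbour 1≤ = let (x , x∈) = 1≤∣p∣⇒Nonempty 1≤ ; (xy , x∈S) = ∈N⁻∩⁻ x∈ in x , x∈S , xy

    out-neighbour : ∀ {x} → 1 ≤ ∣ N⁺ D x ∩ S ∣ → ∃ λ y → y ∈ S × Arc D x y
    out-neighbour 1≤ = let (y , y∈) = 1≤∣p∣⇒Nonempty 1≤ ; (xy , y∈S) = ∈N⁺∩⁻ y∈ in y , y∈S , xy

    in-neighbour-unique : ∀ {x x′ y} → ∣ N⁻ y ∩ S ∣ ≤ 1 →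
                          x ∈ S → Arc D x y → x′ ∈ S → Arc D x′ y → x ≡ x′
    in-neighbour-unique ≤1 x∈S xy x′∈S x′y = ∣p∣≤1⇒unique ≤1 (∈N⁻∩⁺ xy x∈S) (∈N⁻∩⁺ x′y x′∈S)

    out-neighbour-unique : ∀ {x y y′} → ∣ N⁺ D x ∩ S ∣ ≤ 1 →
                           y ∈ S → Arc D x y → y′ ∈ S → Arc D x y′ → y ≡ y′
    out-neighbour-unique ≤1 y∈S xy y′∈S xy′ = ∣p∣≤1⇒unique ≤1 (∈N⁺∩⁺ xy y∈S) (∈N⁺∩⁺ xy′ y′∈S)

    private-out⇔indeg≡1 : ∀ {w} → w ∉ S → (∃ λ x → PrivateOut D S x w) ⇔ ∣ N⁻ w ∩ S ∣ ≡ 1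
    private-out⇔indeg≡1 {w} w∉S = mk⇔ to from
      where
      to : (∃ λ x → PrivateOut D S x w) → ∣ N⁻ w ∩ S ∣ ≡ 1
      to (x , x∈S , inj₁ refl , _)    = contradiction x∈S w∉S
      to (x , x∈S , inj₂ xw , only) =
        unique⇒∣p∣≡1 (∈N⁻∩⁺ xw x∈S) (λ y∈ → let (yw , y∈S) = ∈N⁻∩⁻ y∈ in only _ y∈S (inj₂ yw))
      from : ∣ N⁻ w ∩ S ∣ ≡ 1 → ∃ λ x → PrivateOut D S x w
      from ≡1 = let (x , x∈S , xw) = in-neighbour (≤-reflexive (sym ≡1)) in x , x∈S , inj₂ xw , only x∈S xw
        where
        only : ∀ {x} → x ∈ S → Arc D x w → ∀ y → y ∈ S → (y ≡ w ⊎ Arc D y w) → y ≡ x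
        only x∈S xw y y∈S (inj₁ refl) = contradiction y∈S w∉S
        only x∈S xw y y∈S (inj₂ yw)   = in-neighbour-unique (≤-reflexive ≡1) y∈S yw x∈S xw

  dominating⇒nonempty : ∀ {S} → 1 ≤ n → Dominating D S → Nonempty S
  dominating⇒nonempty {S} 1≤n dom with fromℕ< 1≤n ∈? S
  ... | yes x∈S = _ , x∈S
  ... | no  x∉S = let (x , x∈S , _) = dom _ x∉S in x , x∈S

  outdeg-split : ∀ x S → ∣ N⁺ D x ∩ S ∣ + ∣ N⁺ D x ∩ ∁ S ∣ ≡ outdeg D x
  outdeg-split x S = ∣p∩q∣+∣p∩∁q∣≡∣p∣ (N⁺ D x) S

  arc-double-counting : ∀ P Q → ∑[ x ∈ P ] ∣ N⁺ D x ∩ Q ∣ ≡ ∑[ y ∈ Q ] ∣ N⁻ y ∩ P ∣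
  arc-double-counting P Q = begin
    ∑[ x ∈ P ] ∣ N⁺ D x ∩ Q ∣              ≡⟨ ∑∈-cong P (λ {x} _ → ∣tabulate∩q∣ (arc x) Q) ⟩
    ∑[ x ∈ P ] ∑[ y ∈ Q ] χ (arc x y)      ≡⟨ ∑∈-comm P Q (λ x y → χ (arc x y)) ⟩
    ∑[ y ∈ Q ] ∑[ x ∈ P ] χ (arc x y)      ≡⟨ ∑∈-cong Q (λ {y} _ → ∣tabulate∩q∣ (λ x → arc x y) P) ⟨
    ∑[ y ∈ Q ] ∣ N⁻ y ∩ P ∣                ∎
    where
    open ≡-Reasoning
    ∣tabulate∩q∣ : ∀ (b : Fin n → Bool) q → ∣ tabulate b ∩ q ∣ ≡ ∑[ y ∈ q ] χ (b y)
    ∣tabulate∩q∣ b q = trans (∣p∩q∣≡∑∈ (tabulate b) q) (∑∈-cong q (λ {y} _ → cong χ (lookup∘tabulate b y)))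

  outdeg≤Δ⁺ : ∀ x → outdeg D x ≤ Δ⁺ D
  outdeg≤Δ⁺ x = go (List.allFin n) (∈-allFin x)
    where
    go : ∀ xs → x ∈ₗ xs → outdeg D x ≤ List.foldr _⊔_ 0 (List.map (outdeg D) xs)
    go (y List.∷ xs) (here refl) = m≤m⊔n _ _
    go (y List.∷ xs) (there x∈) = ≤-trans (go xs x∈) (m≤n⊔m _ _)

  Δ⁺-least : ∀ {k} → (∀ x → outdeg D x ≤ k) → Δ⁺ D ≤ k
  Δ⁺-least {k} bound = go (List.allFin n)
    where
    go : ∀ xs → List.foldr _⊔_ 0 (List.map (outdeg D) xs) ≤ k
    go List.[]       = z≤n
    go (x List.∷ xs) = ⊔-lub (bound x) (go xs)

  Δ⁺-attained : ∀ {k} x → outdeg D x ≡ k → (∀ y → outdeg D y ≤ k) → Δ⁺ D ≡ k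
  Δ⁺-attained x refl bound = ≤-antisym (Δ⁺-least bound) (outdeg≤Δ⁺ x)

  -- The counting bounds and their equality cases

  record OpenTight (S : Subset n) : Set where
    field
      indeg≡1   : ∀ y → ∣ N⁻ y ∩ S ∣ ≡ 1
      outdeg≡Δ⁺ : ∀ {x} → x ∈ S → outdeg D x ≡ Δ⁺ D

  record TotalTight (S : Subset n) : Set where
    field
      outer-indeg≡1 : ∀ {y} → y ∉ S → ∣ N⁻ y ∩ S ∣ ≡ 1
      inner-deg≡1   : ∀ {x} → x ∈ S → ∣ N⁺ D x ∩ S ∣ + ∣ N⁻ x ∩ S ∣ ≡ 1
      outdeg≡Δ⁺     : ∀ {x} → x ∈ S → outdeg D x ≡ Δ⁺ D

  n≡∣⊤∣*1 : n ≡ ∣ ⊤ {n} ∣ * 1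
  n≡∣⊤∣*1 = sym (trans (*-identityʳ _) (∣⊤∣≡n n))

  module _ (S : Subset n) where

    ∑outdeg≤∣S∣Δ⁺ : ∑[ x ∈ S ] outdeg D x ≤ ∣ S ∣ * Δ⁺ D
    ∑outdeg≤∣S∣Δ⁺ = ∑∈-≤ S (λ {x} _ → outdeg≤Δ⁺ x)

    ∑indeg≡∑outdeg : ∑[ y ∈ ⊤ ] ∣ N⁻ y ∩ S ∣ ≡ ∑[ x ∈ S ] outdeg D x
    ∑indeg≡∑outdeg = sym (trans (∑∈-cong S (λ {x} _ → cong ∣_∣ (sym (∩-identityʳ (N⁺ D x)))))
                                (arc-double-counting S ⊤))

    open-indeg≥1 : OpenDominating D S → ∀ y → 1 ≤ ∣ N⁻ y ∩ S ∣
    open-indeg≥1 od y = let (x , x∈S , xy) = od y in indeg-pos x∈S xy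

    n≤∑indeg : OpenDominating D S → n ≤ ∑[ y ∈ ⊤ ] ∣ N⁻ y ∩ S ∣
    n≤∑indeg od = ≤-trans (≤-reflexive n≡∣⊤∣*1) (∑∈-≥ ⊤ (λ {y} _ → open-indeg≥1 od y))

    open-bound : OpenDominating D S → n ≤ ∣ S ∣ * Δ⁺ D
    open-bound od = ≤-trans (n≤∑indeg od) (≤-trans (≤-reflexive ∑indeg≡∑outdeg) ∑outdeg≤∣S∣Δ⁺)

    open-bound-tight : OpenDominating D S → ∣ S ∣ * Δ⁺ D ≤ n → OpenTight S
    open-bound-tight od ∣S∣Δ⁺≤n = record
      { indeg≡1   = λ y → ∑∈-≥-tight ⊤ (λ {y} _ → open-indeg≥1 od y) ∑indeg≤n (∈⊤ {x = y})
      ; outdeg≡Δ⁺ = ∑∈-≤-tight S (λ {x} _ → outdeg≤Δ⁺ x) ∣S∣Δ⁺≤∑outdeg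
      }
      where
      ∑indeg≤n : ∑[ y ∈ ⊤ ] ∣ N⁻ y ∩ S ∣ ≤ ∣ ⊤ {n} ∣ * 1
      ∑indeg≤n = ≤-trans (≤-reflexive ∑indeg≡∑outdeg)
        (≤-trans ∑outdeg≤∣S∣Δ⁺ (≤-trans ∣S∣Δ⁺≤n (≤-reflexive n≡∣⊤∣*1)))
      ∣S∣Δ⁺≤∑outdeg : ∣ S ∣ * Δ⁺ D ≤ ∑[ x ∈ S ] outdeg D x
      ∣S∣Δ⁺≤∑outdeg = ≤-trans ∣S∣Δ⁺≤n (≤-trans (n≤∑indeg od) (≤-reflexive ∑indeg≡∑outdeg))

    open-tight⇒≡ : OpenTight S → ∣ S ∣ * Δ⁺ D ≡ n
    open-tight⇒≡ tight = begin
      ∣ S ∣ * Δ⁺ D                   ≡⟨ ∑∈-≡ S outdeg≡Δ⁺ ⟨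
      ∑[ x ∈ S ] outdeg D x          ≡⟨ ∑indeg≡∑outdeg ⟨
      ∑[ y ∈ ⊤ {n} ] ∣ N⁻ y ∩ S ∣    ≡⟨ ∑∈-≡ ⊤ (λ {y} _ → indeg≡1 y) ⟩
      ∣ ⊤ {n} ∣ * 1                  ≡⟨ n≡∣⊤∣*1 ⟨
      n                              ∎
      where
      open OpenTight tight
      open ≡-Reasoning

    inner-arcs outgoing-arcs : ℕ
    inner-arcs    = ∑[ x ∈ S ] ∣ N⁺ D x ∩ S ∣
    outgoing-arcs = ∑[ x ∈ S ] ∣ N⁺ D x ∩ ∁ S ∣

    ∑outer-indeg≡outgoing : ∑[ y ∈ ∁ S ] ∣ N⁻ y ∩ S ∣ ≡ outgoing-arcs
    ∑outer-indeg≡outgoing = sym (arc-double-counting S (∁ S))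

    ∑inner-deg≡2inner : ∑[ x ∈ S ] (∣ N⁺ D x ∩ S ∣ + ∣ N⁻ x ∩ S ∣) ≡ inner-arcs + inner-arcs
    ∑inner-deg≡2inner = trans (∑∈-distrib-+ S _ _) (cong (inner-arcs +_) (sym (arc-double-counting S S)))

    inner+outgoing≡∑outdeg : inner-arcs + outgoing-arcs ≡ ∑[ x ∈ S ] outdeg D x
    inner+outgoing≡∑outdeg = trans (sym (∑∈-distrib-+ S _ _)) (∑∈-cong S (λ {x} _ → outdeg-split x S))

    n≡∣S∣+∣∁S∣ : n ≡ ∣ S ∣ + ∣ ∁ S ∣
    n≡∣S∣+∣∁S∣ = sym (trans (cong (∣ S ∣ +_) (∣∁p∣≡n∸∣p∣ S)) (m+[n∸m]≡n (∣p∣≤n S)))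

    dominated-indeg≥1 : Dominating D S → ∀ {y} → y ∈ ∁ S → 1 ≤ ∣ N⁻ y ∩ S ∣
    dominated-indeg≥1 dom y∈∁S = let (x , x∈S , xy) = dom _ (x∈∁p⇒x∉p y∈∁S) in indeg-pos x∈S xy

    inner-deg≥1 : InducedNoIsolated D S → ∀ {x} → x ∈ S → 1 ≤ ∣ N⁺ D x ∩ S ∣ + ∣ N⁻ x ∩ S ∣
    inner-deg≥1 ni x∈S with ni _ x∈S
    ... | w , w∈S , inj₁ xw = ≤-trans (outdeg-pos w∈S xw) (m≤m+n _ _)
    ... | w , w∈S , inj₂ wx = ≤-trans (indeg-pos w∈S wx) (m≤n+m _ _)

    outer-bound : Dominating D S → ∣ ∁ S ∣ ≤ outgoing-arcs
    outer-bound dom = begin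
      ∣ ∁ S ∣                        ≡⟨ *-identityʳ _ ⟨
      ∣ ∁ S ∣ * 1                    ≤⟨ ∑∈-≥ (∁ S) (dominated-indeg≥1 dom) ⟩
      ∑[ y ∈ ∁ S ] ∣ N⁻ y ∩ S ∣      ≡⟨ ∑outer-indeg≡outgoing ⟩
      outgoing-arcs                  ∎
      where open ≤-Reasoning

    inner-bound : InducedNoIsolated D S → ∣ S ∣ ≤ inner-arcs + inner-arcs
    inner-bound ni = begin
      ∣ S ∣                                           ≡⟨ *-identityʳ _ ⟨
      ∣ S ∣ * 1                                       ≤⟨ ∑∈-≥ S (inner-deg≥1 ni) ⟩
      ∑[ x ∈ S ] (∣ N⁺ D x ∩ S ∣ + ∣ N⁻ x ∩ S ∣)      ≡⟨ ∑inner-deg≡2inner ⟩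
      inner-arcs + inner-arcs                         ∎
      where open ≤-Reasoning

    arc-bound : inner-arcs + outgoing-arcs ≤ ∣ S ∣ * Δ⁺ D
    arc-bound = ≤-trans (≤-reflexive inner+outgoing≡∑outdeg) ∑outdeg≤∣S∣Δ⁺

    total-bound : TotalDominating D S → 2 * n ≤ ∣ S ∣ * (2 * Δ⁺ D + 1)
    total-bound (dom , ni) = subst (λ m → 2 * m ≤ ∣ S ∣ * (2 * Δ⁺ D + 1)) (sym n≡∣S∣+∣∁S∣)
      (total-arithmetic (outer-bound dom) (inner-bound ni) arc-bound)

    total-bound-tight : TotalDominating D S → ∣ S ∣ * (2 * Δ⁺ D + 1) ≤ 2 * n → TotalTight S
    total-bound-tight (dom , ni) ≤2n = record
      { outer-indeg≡1 = λ y∉S → ∑∈-≥-tight (∁ S) (dominated-indeg≥1 dom)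
                          (≤-reflexive (trans ∑outer-indeg≡outgoing (trans (sym c≡b) (sym (*-identityʳ _)))))
                          (x∉p⇒x∈∁p y∉S)
      ; inner-deg≡1   = ∑∈-≥-tight S (inner-deg≥1 ni)
                          (≤-reflexive (trans ∑inner-deg≡2inner (trans (sym g≡2a) (sym (*-identityʳ _)))))
      ; outdeg≡Δ⁺     = ∑∈-≤-tight S (λ {x} _ → outdeg≤Δ⁺ x)
                          (≤-reflexive (trans (sym a+b≡gΔ⁺) inner+outgoing≡∑outdeg))
      }
      where
      equalities : ∣ ∁ S ∣ ≡ outgoing-arcs × ∣ S ∣ ≡ inner-arcs + inner-arcs
                 × inner-arcs + outgoing-arcs ≡ ∣ S ∣ * Δ⁺ D
      equalities = total-arithmetic-tight (outer-bound dom) (inner-bound ni) arc-bound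
                     (subst (λ m → ∣ S ∣ * (2 * Δ⁺ D + 1) ≤ 2 * m) n≡∣S∣+∣∁S∣ ≤2n)
      c≡b    = proj₁ equalities
      g≡2a   = proj₁ (proj₂ equalities)
      a+b≡gΔ⁺ = proj₂ (proj₂ equalities)

    total-tight⇒≡ : TotalTight S → ∣ S ∣ * (2 * Δ⁺ D + 1) ≡ 2 * n
    total-tight⇒≡ tight =
      subst (λ m → ∣ S ∣ * (2 * Δ⁺ D + 1) ≡ 2 * m) (sym n≡∣S∣+∣∁S∣) (total-arithmetic-≡ c≡b g≡2a a+b≡gΔ⁺)
      where
      open TotalTight tight
      c≡b : ∣ ∁ S ∣ ≡ outgoing-arcs
      c≡b = trans (sym (trans (∑∈-≡ (∁ S) (outer-indeg≡1 ∘ x∈∁p⇒x∉p)) (*-identityʳ _)))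
                  ∑outer-indeg≡outgoing
      g≡2a : ∣ S ∣ ≡ inner-arcs + inner-arcs
      g≡2a = trans (sym (trans (∑∈-≡ S inner-deg≡1) (*-identityʳ _))) ∑inner-deg≡2inner
      a+b≡gΔ⁺ : inner-arcs + outgoing-arcs ≡ ∣ S ∣ * Δ⁺ D
      a+b≡gΔ⁺ = trans inner+outgoing≡∑outdeg (∑∈-≡ S outdeg≡Δ⁺)

  -- Tight open dominating sets are the cores of the digraphs in Σ

  open-tight⇒Σ : ∀ {S} → OpenTight S → InΣ D
  open-tight⇒Σ {S} tight =
      Δ⁺ D , S
    , (λ x _ → in-neighbour (≤-reflexive (sym (indeg≡1 x))))
    , (λ x _ _ _ y∈S z∈S yx zx → in-neighbour-unique (≤-reflexive (indeg≡1 x)) y∈S yx z∈S zx)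
    , (λ x _ → ≤-trans (∣p∩q∣≤∣p∣ (N⁺ D x) S) (outdeg≤Δ⁺ x))
    , (λ x x∈S → trans (sym (m+n∸m≡n ∣ N⁺ D x ∩ S ∣ _))
                       (cong (_∸ ∣ N⁺ D x ∩ S ∣) (trans (outdeg-split x S) (outdeg≡Δ⁺ x∈S))))
    , (λ w w∉S → Equivalence.from (private-out⇔indeg≡1 w∉S) (indeg≡1 w))
    , (λ w _ → outdeg≤Δ⁺ w)
    where open OpenTight tight

  Σ⇒open-tight : 1 ≤ n → InΣ D → ∃ λ C → OpenDominating D C × OpenTight C
  Σ⇒open-tight 1≤n (k , C , has-in , in-unique , inner≤k , outer≡ , private-out , outer-outdeg≤k) =
    C , dominating , record { indeg≡1 = indeg≡1 ; outdeg≡Δ⁺ = λ x∈C → trans (core-outdeg x∈C) (sym Δ⁺≡k) }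
    where
    indeg≡1 : ∀ y → ∣ N⁻ y ∩ C ∣ ≡ 1
    indeg≡1 y with y ∈? C
    ... | yes y∈C = let (x , x∈C , xy) = has-in y y∈C in
      unique⇒∣p∣≡1 (∈N⁻∩⁺ xy x∈C)
        (λ z∈ → let (zy , z∈C) = ∈N⁻∩⁻ z∈ in in-unique y _ x y∈C z∈C x∈C zy xy)
    ... | no  y∉C = Equivalence.to (private-out⇔indeg≡1 y∉C) (private-out y y∉C)
    dominating : OpenDominating D C
    dominating y = in-neighbour (≤-reflexive (sym (indeg≡1 y)))
    core-outdeg : ∀ {x} → x ∈ C → outdeg D x ≡ k
    core-outdeg {x} x∈C = trans (sym (outdeg-split x C))
      (trans (cong (∣ N⁺ D x ∩ C ∣ +_) (outer≡ x x∈C)) (m+[n∸m]≡n (inner≤k x x∈C)))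
    outdeg≤k : ∀ x → outdeg D x ≤ k
    outdeg≤k x with x ∈? C
    ... | yes x∈C = ≤-reflexive (core-outdeg x∈C)
    ... | no  x∉C = outer-outdeg≤k x x∉C
    Δ⁺≡k : Δ⁺ D ≡ k
    Δ⁺≡k = let (x , x∈C) = dominating⇒nonempty 1≤n (λ y _ → dominating y) in
      Δ⁺-attained x (core-outdeg x∈C) outdeg≤k

  -- Tight total dominating sets are the cores of the digraphs in Θ

  total-tight⇒dominating : ∀ {S} → TotalTight S → TotalDominating D S
  total-tight⇒dominating {S} tight =
    (λ y y∉S → in-neighbour (≤-reflexive (sym (outer-indeg≡1 y∉S)))) , not-isolated
    where
    open TotalTight tight
    not-isolated : InducedNoIsolated D S
    not-isolated x x∈S with m+n≡1⇒[1,0]⊎[0,1] _ _ (inner-deg≡1 x∈S)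
    ... | inj₁ (out≡1 , _) = let (y , y∈S , xy) = out-neighbour (≤-reflexive (sym out≡1)) in y , y∈S , inj₁ xy
    ... | inj₂ (_ , in≡1)  = let (y , y∈S , yx) = in-neighbour (≤-reflexive (sym in≡1)) in y , y∈S , inj₂ yx

  -- Each vertex of S has exactly one neighbour in S, so the arcs inside S match
  -- their sources u i with their targets v i.
  module TightTotalMatching {S : Subset n} (tight : TotalTight S) where
    open TotalTight tight

    inner-split : ∀ {x} → x ∈ S →
                  (∣ N⁺ D x ∩ S ∣ ≡ 1 × ∣ N⁻ x ∩ S ∣ ≡ 0) ⊎ (∣ N⁺ D x ∩ S ∣ ≡ 0 × ∣ N⁻ x ∩ S ∣ ≡ 1)
    inner-split x∈S = m+n≡1⇒[1,0]⊎[0,1] _ _ (inner-deg≡1 x∈S)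

    source-of-arc : ∀ {x y} → x ∈ S → y ∈ S → Arc D x y → ∣ N⁺ D x ∩ S ∣ ≡ 1 × ∣ N⁻ x ∩ S ∣ ≡ 0
    source-of-arc x∈S y∈S xy with inner-split x∈S
    ... | inj₁ split       = split
    ... | inj₂ (out≡0 , _) = contradiction (subst (1 ≤_) out≡0 (outdeg-pos y∈S xy)) λ ()

    target-of-arc : ∀ {x y} → x ∈ S → y ∈ S → Arc D x y → ∣ N⁺ D y ∩ S ∣ ≡ 0 × ∣ N⁻ y ∩ S ∣ ≡ 1
    target-of-arc x∈S y∈S xy with inner-split y∈S
    ... | inj₁ (_ , in≡0) = contradiction (subst (1 ≤_) in≡0 (indeg-pos x∈S xy)) λ ()
    ... | inj₂ split      = split

    IsSource : Fin n → Set
    IsSource x = x ∈ S × ∣ N⁺ D x ∩ S ∣ ≡ 1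

    sources : Enumeration IsSource
    sources = enumerate (λ x → (x ∈? S) ×-dec (∣ N⁺ D x ∩ S ∣ ℕ.≟ 1))

    open Enumeration sources public
      renaming (size to r; at to u; injective to u-injective; sound to u-source; complete to u-complete)

    u∈S : ∀ i → u i ∈ S
    u∈S i = proj₁ (u-source i)

    matched : ∀ i → ∃ λ y → y ∈ S × Arc D (u i) y
    matched i = out-neighbour (≤-reflexive (sym (proj₂ (u-source i))))

    v : Fin r → Fin n
    v i = proj₁ (matched i)

    v∈S : ∀ i → v i ∈ S
    v∈S i = proj₁ (proj₂ (matched i))

    u→v : ∀ i → Arc D (u i) (v i)
    u→v i = proj₂ (proj₂ (matched i))

    ¬arc-into-u : ∀ {x} i → x ∈ S → ¬ Arc D x (u i)
    ¬arc-into-u i x∈S xu = 0≢1+n (trans (sym (proj₂ (source-of-arc (u∈S i) (v∈S i) (u→v i))))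
                                        (proj₂ (target-of-arc x∈S (u∈S i) xu)))

    ¬arc-from-v : ∀ {y} i → y ∈ S → ¬ Arc D (v i) y
    ¬arc-from-v i y∈S vy = 0≢1+n (trans (sym (proj₁ (target-of-arc (u∈S i) (v∈S i) (u→v i))))
                                        (proj₁ (source-of-arc (v∈S i) y∈S vy)))

    arc-into-v : ∀ i j → Arc D (u i) (v j) → i ≡ j
    arc-into-v i j uv = u-injective i j
      (in-neighbour-unique (≤-reflexive (proj₂ (target-of-arc (u∈S j) (v∈S j) (u→v j))))
                           (u∈S i) uv (u∈S j) (u→v j))

    cover : ∀ x → x ∈ S → ∃ λ i → x ≡ u i ⊎ x ≡ v i
    cover x x∈S with inner-split x∈S
    ... | inj₁ (out≡1 , _) = let (i , ui≡x) = u-complete (x∈S , out≡1) in i , inj₁ (sym ui≡x)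
    ... | inj₂ (_ , in≡1)  =
      let (z , z∈S , zx) = in-neighbour (≤-reflexive (sym in≡1))
          (i , ui≡z)     = u-complete (z∈S , proj₁ (source-of-arc z∈S x∈S zx))
          ux             = subst (λ w → Arc D w x) (sym ui≡z) zx
      in i , inj₂ (out-neighbour-unique (≤-reflexive (proj₂ (u-source i))) x∈S ux (v∈S i) (u→v i))

  total-tight⇒Θ : ∀ {S} → 1 ≤ n → TotalTight S → InΘ D
  total-tight⇒Θ {S} 1≤n tight =
      k , r , S , u , v , 1≤r , u-injective
    , (λ i j vi≡vj → arc-into-v i j (subst (Arc D (u i)) vi≡vj (u→v i)))
    , (λ i j ui≡vj → ¬arc-into-u i (u∈S j) (subst (Arc D (u j)) (sym ui≡vj) (u→v j)))
    , (λ i → u∈S i , v∈S i) , cover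
    , (λ i j → ¬-not (¬arc-into-u j (u∈S i)))
    , (λ i j → ¬-not (¬arc-from-v i (v∈S j)))
    , (λ i j → ¬-not (¬arc-from-v i (u∈S j)))
    , arc-into-v , u→v
    , (λ i → suc-injective (trans (cong (_+ ∣ N⁺ D (u i) ∩ ∁ S ∣) (sym (proj₂ (u-source i))))
                                  (outdeg≡1+k (u∈S i))))
    , (λ i → trans (cong (_+ ∣ N⁺ D (v i) ∩ ∁ S ∣) (sym (proj₁ (target-of-arc (u∈S i) (v∈S i) (u→v i)))))
                   (outdeg≡1+k (v∈S i)))
    , (λ w w∉S → Equivalence.from (private-out⇔indeg≡1 w∉S) (outer-indeg≡1 w∉S))
    , (λ w _ → subst (outdeg D w ≤_) Δ⁺≡1+k (outdeg≤Δ⁺ w))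
    where
    open TotalTight tight
    open TightTotalMatching tight
    i₀ : Fin r
    i₀ = let (x , x∈S) = dominating⇒nonempty 1≤n (proj₁ (total-tight⇒dominating tight)) in proj₁ (cover x x∈S)
    1≤r : 1 ≤ r
    1≤r = ≤-trans (s≤s z≤n) (toℕ<n i₀)
    k : ℕ
    k = Δ⁺ D ∸ 1
    Δ⁺≡1+k : Δ⁺ D ≡ suc k
    Δ⁺≡1+k = sym (m+[n∸m]≡n (begin
      1                          ≤⟨ outdeg-pos (v∈S i₀) (u→v i₀) ⟩
      ∣ N⁺ D (u i₀) ∩ S ∣        ≤⟨ ∣p∩q∣≤∣p∣ (N⁺ D (u i₀)) S ⟩
      outdeg D (u i₀)            ≤⟨ outdeg≤Δ⁺ (u i₀) ⟩
      Δ⁺ D                       ∎))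
      where open ≤-Reasoning
    outdeg≡1+k : ∀ {x} → x ∈ S → ∣ N⁺ D x ∩ S ∣ + ∣ N⁺ D x ∩ ∁ S ∣ ≡ suc k
    outdeg≡1+k {x} x∈S = trans (outdeg-split x S) (trans (outdeg≡Δ⁺ x∈S) Δ⁺≡1+k)

  module ΘCoreMatching
    {C : Subset n} {r : ℕ} {u v : Fin r → Fin n}
    (u∈C : ∀ i → u i ∈ C) (v∈C : ∀ i → v i ∈ C)
    (cover : ∀ x → x ∈ C → ∃ λ i → x ≡ u i ⊎ x ≡ v i)
    (¬uu : ∀ i j → arc (u i) (u j) ≡ false)
    (¬vv : ∀ i j → arc (v i) (v j) ≡ false)
    (¬vu : ∀ i j → arc (v i) (u j) ≡ false)
    (uv⇒≡ : ∀ i j → Arc D (u i) (v j) → i ≡ j)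
    (u→v : ∀ i → Arc D (u i) (v i))
    where

    ¬arc-into-u : ∀ {x} i → x ∈ C → ¬ Arc D x (u i)
    ¬arc-into-u i x∈C xu with cover _ x∈C
    ... | j , inj₁ refl = not-¬ (¬uu j i) xu
    ... | j , inj₂ refl = not-¬ (¬vu j i) xu

    ¬arc-from-v : ∀ {y} i → y ∈ C → ¬ Arc D (v i) y
    ¬arc-from-v i y∈C vy with cover _ y∈C
    ... | j , inj₁ refl = not-¬ (¬vu i j) vy
    ... | j , inj₂ refl = not-¬ (¬vv i j) vy

    arc-from-u : ∀ {y} i → y ∈ C → Arc D (u i) y → y ≡ v i
    arc-from-u i y∈C uy with cover _ y∈C
    ... | j , inj₁ refl = contradiction uy (¬arc-into-u j (u∈C i))
    ... | j , inj₂ refl = cong v (sym (uv⇒≡ i j uy))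

    arc-into-v : ∀ {x} i → x ∈ C → Arc D x (v i) → x ≡ u i
    arc-into-v i x∈C xv with cover _ x∈C
    ... | j , inj₁ refl = cong u (uv⇒≡ j i xv)
    ... | j , inj₂ refl = contradiction xv (¬arc-from-v j (v∈C i))

    u-out≡1 : ∀ i → ∣ N⁺ D (u i) ∩ C ∣ ≡ 1
    u-out≡1 i = unique⇒∣p∣≡1 (∈N⁺∩⁺ (u→v i) (v∈C i))
      (λ y∈ → let (uy , y∈C) = ∈N⁺∩⁻ y∈ in arc-from-u i y∈C uy)

    u-in≡0 : ∀ i → ∣ N⁻ (u i) ∩ C ∣ ≡ 0
    u-in≡0 i = Empty⇒∣p∣≡0 (λ (x , x∈) → let (xu , x∈C) = ∈N⁻∩⁻ x∈ in ¬arc-into-u i x∈C xu)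

    v-out≡0 : ∀ i → ∣ N⁺ D (v i) ∩ C ∣ ≡ 0
    v-out≡0 i = Empty⇒∣p∣≡0 (λ (y , y∈) → let (vy , y∈C) = ∈N⁺∩⁻ y∈ in ¬arc-from-v i y∈C vy)

    v-in≡1 : ∀ i → ∣ N⁻ (v i) ∩ C ∣ ≡ 1
    v-in≡1 i = unique⇒∣p∣≡1 (∈N⁻∩⁺ (u→v i) (u∈C i))
      (λ x∈ → let (xv , x∈C) = ∈N⁻∩⁻ x∈ in arc-into-v i x∈C xv)

  Θ⇒total-tight : InΘ D → ∃ λ C → TotalDominating D C × TotalTight C
  Θ⇒total-tight (k , r , C , u , v , 1≤r , _ , _ , _ , ∈C , cover , ¬uu , ¬vv , ¬vu , uv⇒≡ , u→v ,
                 u-outer , v-outer , private-out , outer-outdeg≤) =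
    C , total-tight⇒dominating tight , tight
    where
    open ΘCoreMatching (proj₁ ∘ ∈C) (proj₂ ∘ ∈C) cover ¬uu ¬vv ¬vu uv⇒≡ u→v
    core-outdeg : ∀ {x} → x ∈ C → outdeg D x ≡ suc k
    core-outdeg x∈C with cover _ x∈C
    ... | i , inj₁ refl = trans (sym (outdeg-split (u i) C)) (cong₂ _+_ (u-out≡1 i) (u-outer i))
    ... | i , inj₂ refl = trans (sym (outdeg-split (v i) C)) (cong₂ _+_ (v-out≡0 i) (v-outer i))
    inner-deg≡1 : ∀ {x} → x ∈ C → ∣ N⁺ D x ∩ C ∣ + ∣ N⁻ x ∩ C ∣ ≡ 1
    inner-deg≡1 x∈C with cover _ x∈C
    ... | i , inj₁ refl = cong₂ _+_ (u-out≡1 i) (u-in≡0 i)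
    ... | i , inj₂ refl = cong₂ _+_ (v-out≡0 i) (v-in≡1 i)
    outdeg≤1+k : ∀ x → outdeg D x ≤ suc k
    outdeg≤1+k x with x ∈? C
    ... | yes x∈C = ≤-reflexive (core-outdeg x∈C)
    ... | no  x∉C = outer-outdeg≤ x x∉C
    Δ⁺≡1+k : Δ⁺ D ≡ suc k
    Δ⁺≡1+k = let i₀ = fromℕ< 1≤r in Δ⁺-attained (u i₀) (core-outdeg (proj₁ (∈C i₀))) outdeg≤1+k
    tight : TotalTight C
    tight = record
      { outer-indeg≡1 = λ {y} y∉C → Equivalence.to (private-out⇔indeg≡1 y∉C) (private-out y y∉C)
      ; inner-deg≡1   = inner-deg≡1
      ; outdeg≡Δ⁺     = λ x∈C → trans (core-outdeg x∈C) (sym Δ⁺≡1+k)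
      }

minimum-attains-bound : ∀ (D : Digraph) {P : Subset (Digraph.n D) → Set} {w b g : ℕ} →
                        IsMinSize D P g → (∀ S → P S → b ≤ ∣ S ∣ * w) →
                        ∀ C → P C → ∣ C ∣ * w ≡ b → g * w ≡ b
minimum-attains-bound D {w = w} {b} ((S , PS , ∣S∣≡g) , minimal) bound C PC ∣C∣w≡b = ≤-antisym
  (≤-trans (*-monoˡ-≤ w (minimal C PC)) (≤-reflexive ∣C∣w≡b))
  (subst (λ m → b ≤ m * w) ∣S∣≡g (bound S PS))

theorem13 : (D : Digraph) → 1 ≤ Digraph.n D →
    (NoIsolated D → ∀ g → IsγT D g →
       (g * (2 * Δ⁺ D + 1) ≡ 2 * Digraph.n D) ⇔ InΘ D)
  × (MinInDeg≥1 D → ∀ g → Isγo D g →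
       (g * Δ⁺ D ≡ Digraph.n D) ⇔ InΣ D)
theorem13 D 1≤n = total-case , open-case
  where
  open Domination D
  -- NoIsolated and MinInDeg≥1 only ensure that γ_t and γ_o exist, which IsγT and Isγo already provide.
  total-case : NoIsolated D → ∀ g → IsγT D g → (g * (2 * Δ⁺ D + 1) ≡ 2 * Digraph.n D) ⇔ InΘ D
  total-case _ g γ@((S , S-td , ∣S∣≡g) , _) = mk⇔
    (λ g-attains → total-tight⇒Θ 1≤n
      (total-bound-tight S S-td (≤-reflexive (trans (cong (_* _) ∣S∣≡g) g-attains))))
    (λ θ → let (C , C-td , C-tight) = Θ⇒total-tight θ in
      minimum-attains-bound D γ total-bound C C-td (total-tight⇒≡ C C-tight))
  open-case : MinInDeg≥1 D → ∀ g → Isγo D g → (g * Δ⁺ D ≡ Digraph.n D) ⇔ InΣ D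
  open-case _ g γ@((S , S-od , ∣S∣≡g) , _) = mk⇔
    (λ g-attains → open-tight⇒Σ
      (open-bound-tight S S-od (≤-reflexive (trans (cong (_* _) ∣S∣≡g) g-attains))))
    (λ σ → let (C , C-od , C-tight) = Σ⇒open-tight 1≤n σ in
      minimum-attains-bound D γ open-bound C C-od (open-tight⇒≡ C C-tight))
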